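{- Let $G=K_{a_1,\dots,a_t}$ be a connected complete $t$-partite graph on $n$ vertices with parts $A_1,\dots,A_t$, $|A_i|=a_i$, and let $r$ be a vertex in part $A_i$. Then $G$ is $r$-stackable if and only if $a_i\le (n+1)/2$. Consequently, $G$ is stackable if and only if $a_i\le (n+1)/2$ for every $i$.
   Context: A configuration is a function $C:V(G)\to\mathbb{N}$ (numbers of cups). A cup stacking move from $u$ to $v$ is allowed when $C(u)\ge1$, $C(v)\ge1$ and $\mathrm{dist}_G(u,v)=C(u)$; it moves all cups of $u$ onto $v$. Let $\mathbf{1}$ be the configuration with one cup on every vertex. $G$ is $r$-stackable if some sequence of moves from $\mathbf{1}$ puts all cups on $r$, and stackable if it is $r$-stackable for every vertex $r$. All graphs in the paper are assumed connected. -}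

module Defs where

open import Data.Nat using (ℕ; zero; suc; _+_; _≤_)
open import Data.Fin using (Fin; _≟_)
open import Data.List using (List; length; filter; allFin)
open import Data.Product using (Σ; ∃; _×_; _,_)
open import Relation.Nullary using (¬_; yes; no)
open import Relation.Binary.PropositionalEquality using (_≡_; _≢_)

Graph : ℕ → Set₁
Graph n = Fin n → Fin n → Set

module _ {n : ℕ} (G : Graph n) where

  data Walk : Fin n → Fin n → ℕ → Set where
    here : ∀ {u} → Walk u u zero
    step : ∀ {u w v k} → G u w → Walk w v k → Walk u (v) (suc k)

  Dist : Fin n → Fin n → ℕ → Set
  Dist u v d = Walk u v d × (∀ k → Walk u v k → d ≤ k)

  Connected : Set
  Connected = ∀ u v → ∃ λ k → Walk u v k

-- Configurations: number of cups on each vertex.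
Config : ℕ → Set
Config n = Fin n → ℕ

one : ∀ {n} → Config n
one _ = 1

moveCups : ∀ {n} → Config n → Fin n → Fin n → Config n
moveCups C u v w with w ≟ u
... | yes _ = 0
... | no _ with w ≟ v
...   | yes _ = C v + C u
...   | no _ = C w

module _ {n : ℕ} (G : Graph n) where

  data Reach : Config n → Config n → Set where
    done : ∀ {C} → Reach C C
    move : ∀ {C C'} (u v : Fin n) →
           1 ≤ C u → 1 ≤ C v → Dist G u v (C u) →
           Reach (moveCups C u v) C' → Reach C C'

  Stackable-at : Fin n → Set
  Stackable-at r = ∃ λ C → Reach one C × (∀ w → w ≢ r → C w ≡ 0)

  Stackable : Set
  Stackable = ∀ r → Stackable-at r

-- Complete multipartite graph on Fin n with parts indexed by Fin t:
-- vertex v lies in part (part v); two vertices are adjacent iff their parts differ.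
CompleteMultipartite : ∀ {n t} → (Fin n → Fin t) → Graph n
CompleteMultipartite part u v = part u ≢ part v

partSize : ∀ {n t} → (Fin n → Fin t) → Fin t → ℕ
partSize {n} part i = length (filter (λ v → part v ≟ i) (allFin n))

-- Distances in a complete multipartite graph are 1 across parts and 2 within a part, so a single
-- cup can only jump to another part and a pair of cups only within its part; larger stacks are
-- stuck. Call a vertex other than r a lone sibling (lone outsider) if it lies in r's part (in
-- another part) and holds exactly one cup. Along any sequence gathering everything on r, no
-- outsider ever holds two cups and no sibling three. Then no move increases the number of lone
-- outsiders minus the number of lone siblings, which is nonnegative at the end, so initially
-- a_i − 1 ≤ n − a_i.
-- Conversely, while lone outsiders remain, one of them either jumps to r or tops up a lone
-- sibling to two cups, which then jumps to r.

module Submission where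

open import Defs
open import Data.Fin using (Fin; zero; suc; punchIn; _≟_)
open import Data.Fin.Properties using (punchInᵢ≢i)
open import Data.List using (length; filter; tabulate)
open import Data.Nat using (ℕ; zero; suc; _+_; _*_; _≤_; z≤n; s≤s; s≤s⁻¹)
open import Data.Nat.Properties hiding (_≟_)
open import Algebra.Properties.CommutativeMonoid.Sum +-0-commutativeMonoid
  using (sum; sum-remove; ∑-distrib-+; sum-cong-≗; sum-syntax)
open import Data.Nat.Tactic.RingSolver using (solve-∀)
open import Data.Product using (∃; _×_; _,_; proj₁; proj₂)
open import Data.Sum using (_⊎_; inj₁; inj₂)
open import Data.Vec.Functional using (Vector; updateAt)
open import Data.Vec.Functional.Properties using (updateAt-updates; updateAt-minimal)
open import Function using (_∘_; const; id)
open import Function.Bundles using (_⇔_; mk⇔; Equivalence)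
open import Relation.Nullary using (Dec; yes; no; ¬_; ¬?; _×-dec_; contradiction)
open import Relation.Unary using (Pred; Decidable)
open import Relation.Unary.Properties using (∁?)
open import Relation.Binary.PropositionalEquality

sum-update : ∀ {n} (f g : Vector ℕ n) (u : Fin n) → (∀ w → w ≢ u → f w ≡ g w) →
  sum f + g u ≡ sum g + f u
sum-update {suc n} f g u f≡g = begin
  sum f + g u                             ≡⟨ cong (_+ g u) (sum-remove {i = u} f) ⟩
  f u + sum (f ∘ punchIn u) + g u         ≡⟨ cong (λ s → f u + s + g u) (sum-cong-≗ away) ⟩
  f u + sum (g ∘ punchIn u) + g u         ≡⟨ swap (f u) _ (g u) ⟩
  g u + sum (g ∘ punchIn u) + f u         ≡⟨ cong (_+ f u) (sum-remove {i = u} g) ⟨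
  sum g + f u                             ∎
  where
  open ≡-Reasoning
  away : f ∘ punchIn u ≗ g ∘ punchIn u
  away j = f≡g (punchIn u j) (punchInᵢ≢i u j)
  swap : ∀ a s b → a + s + b ≡ b + s + a
  swap = solve-∀

sum-update₂ : ∀ {n} (f g : Vector ℕ n) {u v : Fin n} → u ≢ v →
  (∀ w → w ≢ u → w ≢ v → f w ≡ g w) →
  sum f + g u + g v ≡ sum g + f u + f v
sum-update₂ f g {u} {v} u≢v f≡g = begin
  sum f + g u + g v      ≡⟨ cong (λ x → sum f + x + g v) (updateAt-updates u f) ⟨
  sum f + m u + g v      ≡⟨ cong (_+ g v) (sum-update f m u f≡m) ⟩
  sum m + f u + g v      ≡⟨ swap (sum m) (f u) (g v) ⟩
  sum m + g v + f u      ≡⟨ cong (_+ f u) (sum-update m g v m≡g) ⟩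
  sum g + m v + f u      ≡⟨ cong (λ x → sum g + x + f u) (updateAt-minimal v u f (u≢v ∘ sym)) ⟩
  sum g + f v + f u      ≡⟨ swap (sum g) (f v) (f u) ⟩
  sum g + f u + f v      ∎
  where
  open ≡-Reasoning
  m : Vector ℕ _
  m = updateAt f u (const (g u))
  f≡m : ∀ w → w ≢ u → f w ≡ m w
  f≡m w w≢u = sym (updateAt-minimal w u f w≢u)
  m≡g : ∀ w → w ≢ v → m w ≡ g w
  m≡g w w≢v with w ≟ u
  ... | yes refl = updateAt-updates w f
  ... | no w≢u = trans (updateAt-minimal w u f w≢u) (f≡g w w≢u w≢v)
  swap : ∀ a b c → a + b + c ≡ a + c + b
  swap = solve-∀

≤-sum : ∀ {n} (f : Vector ℕ n) w → f w ≤ sum f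
≤-sum {suc n} f w = subst (f w ≤_) (sym (sum-remove {i = w} f)) (m≤m+n _ _)

sum-positive : ∀ {n} (f : Vector ℕ n) → 1 ≤ sum f → ∃ λ w → 1 ≤ f w
sum-positive {suc n} f 1≤sum with f zero in f₀≡
... | suc _ = zero , subst (1 ≤_) (sym f₀≡) (s≤s z≤n)
... | zero with sum-positive (f ∘ suc) 1≤sum
...   | w , 1≤fw = suc w , 1≤fw

indicator : ∀ {a} {A : Set a} → Dec A → ℕ
indicator (yes _) = 1
indicator (no _) = 0

count : ∀ {n p} {P : Pred (Fin n) p} → Decidable P → ℕ
count {n} P? = ∑[ w < n ] indicator (P? w)

count-∁ : ∀ {n p} {P : Pred (Fin n) p} (P? : Decidable P) → count (∁? P?) + count P? ≡ n
count-∁ {n} P? = begin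
  count (∁? P?) + count P?                            ≡⟨ ∑-distrib-+ (indicator ∘ ∁? P?) (indicator ∘ P?) ⟨
  ∑[ w < n ] (indicator (∁? P? w) + indicator (P? w)) ≡⟨ sum-cong-≗ either ⟩
  ∑[ w < n ] 1                                        ≡⟨ ∑1≡ n ⟩
  n                                                   ∎
  where
  open ≡-Reasoning
  either : ∀ w → indicator (∁? P? w) + indicator (P? w) ≡ 1
  either w with P? w
  ... | yes _ = refl
  ... | no _ = refl
  ∑1≡ : ∀ m → ∑[ w < m ] 1 ≡ m
  ∑1≡ zero = refl
  ∑1≡ (suc m) = cong suc (∑1≡ m)

count-remove : ∀ {n p} {P : Pred (Fin n) p} (P? : Decidable P) {r : Fin n} → P r →
  count (λ w → P? w ×-dec ¬? (w ≟ r)) + 1 ≡ count P?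
count-remove P? {r} Pr = begin
  count (λ w → P? w ×-dec ¬? (w ≟ r)) + 1     ≡⟨ cong (count (λ w → P? w ×-dec ¬? (w ≟ r)) +_) at-r ⟨
  count (λ w → P? w ×-dec ¬? (w ≟ r)) + indicator (P? r)
    ≡⟨ sum-update _ _ r away ⟩
  count P? + indicator (P? r ×-dec ¬? (r ≟ r)) ≡⟨ cong (count P? +_) removed ⟩
  count P? + 0                                ≡⟨ +-identityʳ _ ⟩
  count P?                                    ∎
  where
  open ≡-Reasoning
  at-r : indicator (P? r) ≡ 1
  at-r with P? r
  ... | yes _ = refl
  ... | no ¬Pr = contradiction Pr ¬Pr
  removed : indicator (P? r ×-dec ¬? (r ≟ r)) ≡ 0
  removed with P? r ×-dec ¬? (r ≟ r)
  ... | yes (_ , r≢r) = contradiction refl r≢r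
  ... | no _ = refl
  away : ∀ w → w ≢ r → indicator (P? w ×-dec ¬? (w ≟ r)) ≡ indicator (P? w)
  away w w≢r with P? w | w ≟ r
  ... | _ | yes w≡r = contradiction w≡r w≢r
  ... | yes _ | no _ = refl
  ... | no _ | no _ = refl

length-filter-tabulate : ∀ {n a p} {A : Set a} {P : Pred A p} (P? : Decidable P) (f : Fin n → A) →
  length (filter P? (tabulate f)) ≡ ∑[ i < n ] indicator (P? (f i))
length-filter-tabulate {zero} P? f = refl
length-filter-tabulate {suc n} P? f with P? (f zero)
... | yes _ = cong suc (length-filter-tabulate P? (f ∘ suc))
... | no _ = length-filter-tabulate P? (f ∘ suc)

moveCups-source : ∀ {n} (C : Config n) u v → moveCups C u v u ≡ 0
moveCups-source C u v with u ≟ u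
... | yes _ = refl
... | no u≢u = contradiction refl u≢u

module _ {n : ℕ} (C : Config n) {u v : Fin n} where

  moveCups-target : u ≢ v → moveCups C u v v ≡ C v + C u
  moveCups-target u≢v with v ≟ u
  ... | yes v≡u = contradiction (sym v≡u) u≢v
  ... | no _ with v ≟ v
  ...   | yes _ = refl
  ...   | no v≢v = contradiction refl v≢v

  moveCups-other : ∀ {w} → w ≢ u → w ≢ v → moveCups C u v w ≡ C w
  moveCups-other {w} w≢u w≢v with w ≟ u
  ... | yes w≡u = contradiction w≡u w≢u
  ... | no _ with w ≟ v
  ...   | yes w≡v = contradiction w≡v w≢v
  ...   | no _ = refl

  moveCups-≥ : u ≢ v → ∀ {w} → w ≢ u → C w ≤ moveCups C u v w
  moveCups-≥ u≢v {w} w≢u with w ≟ v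
  ... | yes refl = subst (C w ≤_) (sym (moveCups-target u≢v)) (m≤m+n _ _)
  ... | no w≢v = ≤-reflexive (sym (moveCups-other w≢u w≢v))

isOne : ℕ → ℕ
isOne 1 = 1
isOne _ = 0

module Lone {n p} {P : Pred (Fin n) p} (P? : Decidable P) where

  weight : Fin n → ℕ → ℕ
  weight w c with P? w
  ... | yes _ = isOne c
  ... | no _ = 0

  lone : Config n → ℕ
  lone C = ∑[ w < n ] weight w (C w)

  weight-∉ : ∀ {w c} → ¬ P w → weight w c ≡ 0
  weight-∉ {w} ¬Pw with P? w
  ... | yes Pw = contradiction Pw ¬Pw
  ... | no _ = refl

  weight-≢1 : ∀ {w c} → c ≢ 1 → weight w c ≡ 0
  weight-≢1 {w} {c} c≢1 with P? w | c
  ... | no _ | _ = refl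
  ... | yes _ | 0 = refl
  ... | yes _ | 1 = contradiction refl c≢1
  ... | yes _ | suc (suc _) = refl

  weight-lone : ∀ {w} → P w → weight w 1 ≡ 1
  weight-lone {w} Pw with P? w
  ... | yes _ = refl
  ... | no ¬Pw = contradiction Pw ¬Pw

  weight≤1 : ∀ w c → weight w c ≤ 1
  weight≤1 w c with P? w | c
  ... | no _ | _ = z≤n
  ... | yes _ | 0 = z≤n
  ... | yes _ | 1 = ≤-refl
  ... | yes _ | suc (suc _) = z≤n

  weight-positive : ∀ {w c} → 1 ≤ weight w c → P w × c ≡ 1
  weight-positive {w} {c} 1≤ with P? w | c
  ... | yes Pw | 1 = Pw , refl
  ... | yes _ | 0 = contradiction 1≤ λ ()
  ... | yes _ | suc (suc _) = contradiction 1≤ λ ()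

  lone-≥1 : ∀ {C w} → P w → C w ≡ 1 → 1 ≤ lone C
  lone-≥1 {C} {w} Pw Cw≡1 =
    ≤-trans (≤-reflexive (sym (trans (cong (weight w) Cw≡1) (weight-lone Pw)))) (≤-sum _ w)

  lone-witness : ∀ {C} → 1 ≤ lone C → ∃ λ w → P w × C w ≡ 1
  lone-witness 1≤ with sum-positive _ 1≤
  ... | w , 1≤weight = w , weight-positive 1≤weight

  lone≡0⊎witness : ∀ C → lone C ≡ 0 ⊎ ∃ λ w → P w × C w ≡ 1
  lone≡0⊎witness C with lone C in eq
  ... | zero = inj₁ refl
  ... | suc _ = inj₂ (lone-witness (subst (1 ≤_) (sym eq) (s≤s z≤n)))

  lone≡0 : ∀ {C} → (∀ w → P w → C w ≢ 1) → lone C ≡ 0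
  lone≡0 {C} noLone with lone≡0⊎witness C
  ... | inj₁ lone≡0 = lone≡0
  ... | inj₂ (w , Pw , Cw≡1) = contradiction Cw≡1 (noLone w Pw)

  lone-one : lone one ≡ count P?
  lone-one = sum-cong-≗ at-one
    where
    at-one : ∀ w → weight w 1 ≡ indicator (P? w)
    at-one w with P? w
    ... | yes _ = refl
    ... | no _ = refl

  module _ (C : Config n) {u v : Fin n} (u≢v : u ≢ v) where

    private
      C' : Config n
      C' = moveCups C u v

    lone-moveCups : lone C + weight v (C v + C u) ≡ lone (moveCups C u v) + (weight u (C u) + weight v (C v))
    lone-moveCups = begin
      lone C + weight v (C v + C u)                 ≡⟨ cong (λ c → lone C + weight v c) (moveCups-target C u≢v) ⟨
      lone C + weight v (C' v)                      ≡⟨ cong (_+ weight v (C' v)) (+-identityʳ (lone C)) ⟨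
      lone C + 0 + weight v (C' v)                  ≡⟨ cong (λ x → lone C + x + weight v (C' v)) emptied ⟨
      lone C + weight u (C' u) + weight v (C' v)    ≡⟨ sum-update₂ _ _ u≢v (λ w w≢u w≢v → cong (weight w) (sym (moveCups-other C w≢u w≢v))) ⟩
      lone C' + weight u (C u) + weight v (C v)     ≡⟨ +-assoc (lone C') _ _ ⟩
      lone C' + (weight u (C u) + weight v (C v))   ∎
      where
      open ≡-Reasoning
      emptied : weight u (C' u) ≡ 0
      emptied = trans (cong (weight u) (moveCups-source C u v)) (weight-≢1 (λ ()))

    private
      drop : weight v (C v + C u) ≡ 0 → weight u (C u) + weight v (C v) ≡ 1 → lone C ≡ suc (lone C')
      drop new≡0 old≡1 = begin
        lone C                                      ≡⟨ +-identityʳ (lone C) ⟨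
        lone C + 0                                  ≡⟨ cong (lone C +_) new≡0 ⟨
        lone C + weight v (C v + C u)               ≡⟨ lone-moveCups ⟩
        lone C' + (weight u (C u) + weight v (C v)) ≡⟨ cong (lone C' +_) old≡1 ⟩
        lone C' + 1                                 ≡⟨ +-comm (lone C') 1 ⟩
        suc (lone C')                               ∎
        where open ≡-Reasoning

    lone-moveCups-≡ : ¬ P v → weight u (C u) ≡ 0 → lone C' ≡ lone C
    lone-moveCups-≡ ¬Pv wu≡0 = begin
      lone C'                                     ≡⟨ +-identityʳ (lone C') ⟨
      lone C' + 0                                 ≡⟨ cong (lone C' +_) (cong₂ _+_ wu≡0 (weight-∉ ¬Pv)) ⟨
      lone C' + (weight u (C u) + weight v (C v)) ≡⟨ lone-moveCups ⟨
      lone C + weight v (C v + C u)               ≡⟨ cong (lone C +_) (weight-∉ ¬Pv) ⟩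
      lone C + 0                                  ≡⟨ +-identityʳ (lone C) ⟩
      lone C                                      ∎
      where open ≡-Reasoning

    lone-moveCups-≤ : ¬ P u → lone C ≤ suc (lone C')
    lone-moveCups-≤ ¬Pu = begin
      lone C                                      ≤⟨ m≤m+n (lone C) _ ⟩
      lone C + weight v (C v + C u)               ≡⟨ lone-moveCups ⟩
      lone C' + (weight u (C u) + weight v (C v)) ≡⟨ cong (λ x → lone C' + (x + weight v (C v))) (weight-∉ ¬Pu) ⟩
      lone C' + weight v (C v)                    ≤⟨ +-monoʳ-≤ (lone C') (weight≤1 v (C v)) ⟩
      lone C' + 1                                 ≡⟨ +-comm (lone C') 1 ⟩
      suc (lone C')                               ∎
      where open ≤-Reasoning

    lone-moveCups-lone : ¬ P v → P u → C u ≡ 1 → lone C ≡ suc (lone C')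
    lone-moveCups-lone ¬Pv Pu Cu≡1 =
      drop (weight-∉ ¬Pv) (cong₂ _+_ (trans (cong (weight u) Cu≡1) (weight-lone Pu)) (weight-∉ ¬Pv))

    lone-moveCups-merge : ¬ P u → P v → C v ≡ 1 → C u ≡ 1 → lone C ≡ suc (lone C')
    lone-moveCups-merge ¬Pu Pv Cv≡1 Cu≡1 =
      drop (weight-≢1 (λ sum≡1 → contradiction (trans (sym (cong₂ _+_ Cv≡1 Cu≡1)) sum≡1) λ ()))
           (cong₂ _+_ (weight-∉ ¬Pu) (trans (cong (weight v) Cv≡1) (weight-lone Pv)))

dist-≢ : ∀ {n} {G : Graph n} {u v d} → Dist G u v d → 1 ≤ d → u ≢ v
dist-≢ (_ , shortest) 1≤d refl = contradiction (≤-trans 1≤d (shortest 0 here)) λ ()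

reach-++ : ∀ {n} {G : Graph n} {C D F} → Reach G C D → Reach G D F → Reach G C F
reach-++ done D→F = D→F
reach-++ (move u v 1≤Cu 1≤Cv d C'→D) D→F = move u v 1≤Cu 1≤Cv d (reach-++ C'→D D→F)

module Multipartite {n t} (part : Fin n → Fin t) where

  G : Graph n
  G = CompleteMultipartite part

  private
    edge : ∀ {u v} → part u ≢ part v → Walk G u v 1
    edge pu≢pv = step pu≢pv here

    detour : ∀ {u v x} → part u ≢ part x → part u ≡ part v → Walk G u v 2
    detour pu≢px pu≡pv = step pu≢px (step (λ px≡pv → pu≢px (trans pu≡pv (sym px≡pv))) here)

  dist-across : ∀ {u v} → part u ≢ part v → Dist G u v 1
  dist-across {u} {v} pu≢pv = edge pu≢pv , shortest
    where
    shortest : ∀ k → Walk G u v k → 1 ≤ k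
    shortest zero here = contradiction refl pu≢pv
    shortest (suc k) _ = s≤s z≤n

  dist-within : ∀ {u v x} → part u ≢ part x → part u ≡ part v → u ≢ v → Dist G u v 2
  dist-within {u} {v} pu≢px pu≡pv u≢v = detour pu≢px pu≡pv , shortest
    where
    shortest : ∀ k → Walk G u v k → 2 ≤ k
    shortest zero here = contradiction refl u≢v
    shortest 1 (step pu≢pv here) = contradiction pu≡pv pu≢pv
    shortest (suc (suc k)) _ = s≤s (s≤s z≤n)

  dist-move : ∀ {u v d} → Dist G u v d → 1 ≤ d →
    (d ≡ 1 × part u ≢ part v) ⊎ (d ≡ 2 × part u ≡ part v × u ≢ v)
  dist-move {d = 1} (step pu≢pv here , _) _ = inj₁ (refl , pu≢pv)
  dist-move {u} {v} {2} (_ , shortest) _ with part u ≟ part v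
  ... | no pu≢pv = contradiction (shortest 1 (edge pu≢pv)) λ { (s≤s ()) }
  ... | yes pu≡pv = inj₂ (refl , pu≡pv , λ { refl → contradiction (shortest 0 here) λ () })
  dist-move {u} {v} {suc (suc (suc _))} (step pu≢px _ , shortest) _ with part u ≟ part v
  ... | no pu≢pv = contradiction (shortest 1 (edge pu≢pv)) λ { (s≤s ()) }
  ... | yes pu≡pv = contradiction (shortest 2 (detour pu≢px pu≡pv)) λ { (s≤s (s≤s ())) }

≤⇔double≤ : ∀ i o → i ≤ o ⇔ 2 * suc i ≤ suc (o + suc i)
≤⇔double≤ i o = mk⇔ (λ i≤o → subst₂ _≤_ (sym (double i)) (sym shift) (s≤s (s≤s (+-monoˡ-≤ i i≤o))))
                    (λ le → +-cancelʳ-≤ i i o (s≤s⁻¹ (s≤s⁻¹ (subst₂ _≤_ (double i) shift le))))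
  where
  double : ∀ i → 2 * suc i ≡ suc (suc (i + i))
  double = solve-∀
  shift : suc (o + suc i) ≡ suc (suc (o + i))
  shift = cong suc (+-suc o i)

module Rooted {n t} (part : Fin n → Fin t) (r : Fin n) where

  open Multipartite part

  Sibling Outsider : Fin n → Set
  Sibling w = part w ≡ part r × w ≢ r
  Outsider w = part w ≢ part r

  samePart? : Decidable (λ w → part w ≡ part r)
  samePart? w = part w ≟ part r

  sibling? : Decidable Sibling
  sibling? w = samePart? w ×-dec ¬? (w ≟ r)

  outsider? : Decidable Outsider
  outsider? = ∁? samePart?

  module S = Lone sibling?
  module O = Lone outsider?

  Gathered : Config n → Set
  Gathered C = ∀ w → w ≢ r → C w ≡ 0

  -- Stacks of two only move within their part and stacks of three never move, so away from r
  -- these bounds hold all along a sequence that gathers everything on r.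
  Sound : Config n → Set
  Sound C = ∀ w → w ≢ r → C w ≤ 2 × (Outsider w → C w ≤ 1)

  reach⇒sound : ∀ {C F} → Reach G C F → Gathered F → Sound C
  reach⇒sound done gathered w w≢r rewrite gathered w w≢r = z≤n , λ _ → z≤n
  reach⇒sound {C} (move u v 1≤Cu 1≤Cv d rest) gathered w w≢r with w ≟ u | dist-move d 1≤Cu
  ... | no w≢u | _ = bounded (moveCups-≥ C (dist-≢ d 1≤Cu) w≢u) (reach⇒sound rest gathered w w≢r)
    where
    bounded : ∀ {a b} → a ≤ b → b ≤ 2 × (Outsider w → b ≤ 1) → a ≤ 2 × (Outsider w → a ≤ 1)
    bounded a≤b (b≤2 , b≤1) = ≤-trans a≤b b≤2 , λ out → ≤-trans a≤b (b≤1 out)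
  ... | yes refl | inj₁ (Cw≡1 , _) = ≤-trans (≤-reflexive Cw≡1) (s≤s z≤n) , λ _ → ≤-reflexive Cw≡1
  ... | yes refl | inj₂ (Cw≡2 , pw≡pv , w≢v) = ≤-reflexive Cw≡2 , λ out → contradiction (bound out) (<⇒≱ too-many)
    where
    bound : Outsider w → moveCups C w v v ≤ 1
    bound out = proj₂ (reach⇒sound rest gathered v (λ v≡r → out (trans pw≡pv (cong part v≡r)))) (out ∘ trans pw≡pv)
    too-many : 2 ≤ moveCups C w v v
    too-many = subst (2 ≤_) (sym (moveCups-target C w≢v)) (≤-trans (≤-reflexive (sym Cw≡2)) (m≤n+m _ _))

  reach⇒balanced : ∀ {C F} → Reach G C F → Gathered F → S.lone C ≤ O.lone C
  reach⇒balanced {F = F} done gathered = subst (_≤ O.lone F) (sym no-lone-sibling) z≤n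
    where
    no-lone-sibling : S.lone F ≡ 0
    no-lone-sibling = S.lone≡0 λ w sib Fw≡1 → contradiction (trans (sym (gathered w (proj₂ sib))) Fw≡1) λ ()
  reach⇒balanced {C} (move u v 1≤Cu 1≤Cv d rest) gathered with dist-move d 1≤Cu
  ... | inj₁ (Cu≡1 , pu≢pv) = begin
    S.lone C          ≤⟨ S.lone-moveCups-≤ C u≢v (pu-out ∘ proj₁) ⟩
    suc (S.lone C')   ≤⟨ s≤s (reach⇒balanced rest gathered) ⟩
    suc (O.lone C')   ≡⟨ O.lone-moveCups-lone C u≢v (λ out → out pv≡pr) pu-out Cu≡1 ⟨
    O.lone C          ∎
    where
    open ≤-Reasoning
    C' : Config n
    C' = moveCups C u v
    u≢v : u ≢ v
    u≢v = pu≢pv ∘ cong part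
    two-cups : 2 ≤ C' v
    two-cups = subst (2 ≤_) (sym (moveCups-target C u≢v)) (+-mono-≤ 1≤Cv (≤-reflexive (sym Cu≡1)))
    pv≡pr : part v ≡ part r
    pv≡pr with v ≟ r | part v ≟ part r
    ... | yes v≡r | _ = cong part v≡r
    ... | no _ | yes pv≡pr = pv≡pr
    ... | no v≢r | no out = contradiction (proj₂ (reach⇒sound rest gathered v v≢r) out) (<⇒≱ two-cups)
    pu-out : Outsider u
    pu-out pu≡pr = pu≢pv (trans pu≡pr (sym pv≡pr))
  ... | inj₂ (Cu≡2 , pu≡pv , u≢v) = subst₂ _≤_ S-same O-same (reach⇒balanced rest gathered)
    where
    three-cups : 3 ≤ moveCups C u v v
    three-cups = subst (3 ≤_) (sym (moveCups-target C u≢v)) (+-mono-≤ 1≤Cv (≤-reflexive (sym Cu≡2)))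
    v≡r : v ≡ r
    v≡r with v ≟ r
    ... | yes v≡r = v≡r
    ... | no v≢r = contradiction (proj₁ (reach⇒sound rest gathered v v≢r)) (<⇒≱ three-cups)
    S-same : S.lone (moveCups C u v) ≡ S.lone C
    S-same = S.lone-moveCups-≡ C u≢v (λ sib → proj₂ sib v≡r)
               (S.weight-≢1 λ Cu≡1 → contradiction (trans (sym Cu≡2) Cu≡1) λ ())
    O-same : O.lone (moveCups C u v) ≡ O.lone C
    O-same = O.lone-moveCups-≡ C u≢v (λ out → out (cong part v≡r))
               (O.weight-∉ λ out → out (trans pu≡pv (cong part v≡r)))

  Sparse : Config n → Set
  Sparse C = 1 ≤ C r × (∀ w → w ≢ r → C w ≤ 1)

  Invariant : ℕ → Config n → Set
  Invariant k C = Sparse C × S.lone C ≤ O.lone C × O.lone C ≡ k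

  sparse-moveCups-root : ∀ {C u} → u ≢ r → 1 ≤ C r → (∀ w → w ≢ r → w ≢ u → C w ≤ 1) →
    Sparse (moveCups C u r)
  sparse-moveCups-root {C} {u} u≢r 1≤Cr others =
    subst (1 ≤_) (sym (moveCups-target C u≢r)) (≤-trans 1≤Cr (m≤m+n _ _)) , λ w w≢r → at w w≢r (w ≟ u)
    where
    at : ∀ w → w ≢ r → Dec (w ≡ u) → moveCups C u r w ≤ 1
    at w w≢r (yes refl) = subst (_≤ 1) (sym (moveCups-source C w r)) z≤n
    at w w≢r (no w≢u) = subst (_≤ 1) (sym (moveCups-other C w≢u w≢r)) (others w w≢r w≢u)

  gathered-when-exhausted : ∀ {C} → Invariant 0 C → Gathered C
  gathered-when-exhausted {C} ((_ , sparse) , balanced , O≡0) w w≢r with C w in Cw≡ | sparse w w≢r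
  ... | 0 | _ = refl
  ... | suc (suc _) | s≤s ()
  ... | 1 | _ with part w ≟ part r
  ...   | yes pw≡pr = contradiction (subst (1 ≤_) S≡0 (S.lone-≥1 (pw≡pr , w≢r) Cw≡)) λ ()
    where
    S≡0 : S.lone C ≡ 0
    S≡0 = n≤0⇒n≡0 (subst (S.lone C ≤_) O≡0 balanced)
  ...   | no out = contradiction (subst (1 ≤_) O≡0 (O.lone-≥1 out Cw≡)) λ ()

  step-to-root : ∀ {k C x} → Invariant (suc k) C → Outsider x → C x ≡ 1 → S.lone C ≡ 0 →
    ∃ λ C' → Reach G C C' × Invariant k C'
  step-to-root {k} {C} {x} ((1≤Cr , sparse) , _ , O≡1+k) out Cx≡1 S≡0 =
    C' , move x r (≤-reflexive (sym Cx≡1)) 1≤Cr (subst (Dist G x r) (sym Cx≡1) (dist-across out)) done ,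
    sparse-moveCups-root x≢r 1≤Cr (λ w w≢r _ → sparse w w≢r) , subst (_≤ O.lone C') (sym S'≡0) z≤n , O'≡k
    where
    C' : Config n
    C' = moveCups C x r
    x≢r : x ≢ r
    x≢r = out ∘ cong part
    S'≡0 : S.lone C' ≡ 0
    S'≡0 = trans (S.lone-moveCups-≡ C x≢r (λ sib → proj₂ sib refl) (S.weight-∉ (out ∘ proj₁))) S≡0
    O'≡k : O.lone C' ≡ k
    O'≡k = suc-injective (trans (sym (O.lone-moveCups-lone C x≢r (λ out-r → out-r refl) out Cx≡1)) O≡1+k)

  step-via-sibling : ∀ {k C x u} → Invariant (suc k) C → Outsider x → C x ≡ 1 → Sibling u → C u ≡ 1 →
    ∃ λ C₂ → Reach G C C₂ × Invariant k C₂
  step-via-sibling {k} {C} {x} {u} ((1≤Cr , sparse) , balanced , O≡1+k) out Cx≡1 (pu≡pr , u≢r) Cu≡1 =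
    C₂ , move x u (≤-reflexive (sym Cx≡1)) (≤-reflexive (sym Cu≡1)) d₁
           (move u r (subst (1 ≤_) (sym C₁u≡2) (s≤s z≤n)) 1≤C₁r d₂ done) ,
    sparse-moveCups-root u≢r 1≤C₁r (λ w w≢r w≢u → at w w≢r w≢u (w ≟ x)) ,
    subst₂ _≤_ (sym S₂≡S₁) (sym O₂≡O₁) (s≤s⁻¹ (subst₂ _≤_ S≡1+S₁ O≡1+O₁ balanced)) ,
    suc-injective (trans (cong suc O₂≡O₁) (trans (sym O≡1+O₁) O≡1+k))
    where
    C₁ C₂ : Config n
    C₁ = moveCups C x u
    C₂ = moveCups C₁ u r
    px≢pu : part x ≢ part u
    px≢pu px≡pu = out (trans px≡pu pu≡pr)
    x≢u : x ≢ u
    x≢u = px≢pu ∘ cong part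
    C₁u≡2 : C₁ u ≡ 2
    C₁u≡2 = trans (moveCups-target C x≢u) (cong₂ _+_ Cu≡1 Cx≡1)
    1≤C₁r : 1 ≤ C₁ r
    1≤C₁r = subst (1 ≤_) (sym (moveCups-other C (out ∘ cong part ∘ sym) (u≢r ∘ sym))) 1≤Cr
    d₁ : Dist G x u (C x)
    d₁ = subst (Dist G x u) (sym Cx≡1) (dist-across px≢pu)
    d₂ : Dist G u r (C₁ u)
    d₂ = subst (Dist G u r) (sym C₁u≡2) (dist-within (px≢pu ∘ sym) pu≡pr u≢r)
    at : ∀ w → w ≢ r → w ≢ u → Dec (w ≡ x) → C₁ w ≤ 1
    at w _ _ (yes refl) = subst (_≤ 1) (sym (moveCups-source C w u)) z≤n
    at w w≢r w≢u (no w≢x) = subst (_≤ 1) (sym (moveCups-other C w≢x w≢u)) (sparse w w≢r)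
    O≡1+O₁ : O.lone C ≡ suc (O.lone C₁)
    O≡1+O₁ = O.lone-moveCups-lone C x≢u (λ out-u → out-u pu≡pr) out Cx≡1
    O₂≡O₁ : O.lone C₂ ≡ O.lone C₁
    O₂≡O₁ = O.lone-moveCups-≡ C₁ u≢r (λ out-r → out-r refl) (O.weight-∉ λ out-u → out-u pu≡pr)
    S≡1+S₁ : S.lone C ≡ suc (S.lone C₁)
    S≡1+S₁ = S.lone-moveCups-merge C x≢u (out ∘ proj₁) (pu≡pr , u≢r) Cu≡1 Cx≡1
    S₂≡S₁ : S.lone C₂ ≡ S.lone C₁
    S₂≡S₁ = S.lone-moveCups-≡ C₁ u≢r (λ sib → proj₂ sib refl)
              (S.weight-≢1 λ C₁u≡1 → contradiction (trans (sym C₁u≡2) C₁u≡1) λ ())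

  gather-step : ∀ {k C} → Invariant (suc k) C → ∃ λ C' → Reach G C C' × Invariant k C'
  gather-step {C = C} inv@(_ , _ , O≡1+k) with O.lone-witness (subst (1 ≤_) (sym O≡1+k) (s≤s z≤n))
  ... | x , out , Cx≡1 with S.lone≡0⊎witness C
  ...   | inj₁ S≡0 = step-to-root inv out Cx≡1 S≡0
  ...   | inj₂ (u , sib , Cu≡1) = step-via-sibling inv out Cx≡1 sib Cu≡1

  gather : ∀ k {C} → Invariant k C → ∃ λ F → Reach G C F × Gathered F
  gather zero inv = _ , done , gathered-when-exhausted inv
  gather (suc k) inv with gather-step inv
  ... | C' , C→C' , inv' with gather k inv'
  ...   | F , C'→F , gathered = F , reach-++ C→C' C'→F , gathered

  partSize≡count : partSize part (part r) ≡ count samePart?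
  partSize≡count = length-filter-tabulate samePart? id

  lone-siblings-one : suc (S.lone one) ≡ partSize part (part r)
  lone-siblings-one = begin
    suc (S.lone one)      ≡⟨ +-comm 1 (S.lone one) ⟩
    S.lone one + 1        ≡⟨ cong (_+ 1) S.lone-one ⟩
    count sibling? + 1    ≡⟨ count-remove samePart? refl ⟩
    count samePart?       ≡⟨ partSize≡count ⟨
    partSize part (part r) ∎
    where open ≡-Reasoning

  lone-outsiders-one : O.lone one + suc (S.lone one) ≡ n
  lone-outsiders-one = begin
    O.lone one + suc (S.lone one)         ≡⟨ cong₂ _+_ O.lone-one lone-siblings-one ⟩
    count outsider? + partSize part (part r) ≡⟨ cong (count outsider? +_) partSize≡count ⟩
    count outsider? + count samePart?      ≡⟨ count-∁ samePart? ⟩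
    n                                      ∎
    where open ≡-Reasoning

  stackable-at⇔ : Stackable-at G r ⇔ 2 * partSize part (part r) ≤ suc n
  stackable-at⇔ = mk⇔ (λ (_ , one→F , gathered) → Equivalence.to balanced⇔ (reach⇒balanced one→F gathered))
                      (λ 2a≤n+1 → gather _ (invariant-one (Equivalence.from balanced⇔ 2a≤n+1)))
    where
    balanced⇔ : S.lone one ≤ O.lone one ⇔ 2 * partSize part (part r) ≤ suc n
    balanced⇔ = subst₂ (λ a m → S.lone one ≤ O.lone one ⇔ 2 * a ≤ suc m)
                  lone-siblings-one lone-outsiders-one (≤⇔double≤ (S.lone one) (O.lone one))
    invariant-one : S.lone one ≤ O.lone one → Invariant (O.lone one) one
    invariant-one balanced = (s≤s z≤n , λ _ _ → s≤s z≤n) , balanced , refl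

corollary12 : ∀ {n t} (part : Fin n → Fin t) →
    (∀ i → ∃ λ v → part v ≡ i) →
    Connected (CompleteMultipartite part) →
    (∀ r → Stackable-at (CompleteMultipartite part) r ⇔ (2 * partSize part (part r) ≤ suc n))
    × (Stackable (CompleteMultipartite part) ⇔ (∀ i → 2 * partSize part i ≤ suc n))
corollary12 {n} part every-part-occupied _ = stackable-at⇔ , mk⇔ all-parts-small every-root
  where
  open Rooted part using (stackable-at⇔)
  all-parts-small : Stackable (CompleteMultipartite part) → ∀ i → 2 * partSize part i ≤ suc n
  all-parts-small stackable i with every-part-occupied i
  ... | v , refl = Equivalence.to (stackable-at⇔ v) (stackable v)
  every-root : (∀ i → 2 * partSize part i ≤ suc n) → Stackable (CompleteMultipartite part)
  every-root small r = Equivalence.from (stackable-at⇔ r) (small (part r))
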